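{- Let $m,n\geq0$ and $\mathbf{u}\in\mathsf{Shuf}(m,n)$. Then $\mathbf{u}$ is join-irreducible in $\mathbf{Bub}(m,n)$ if and only if either $\mathbf{u}=\mathbf{x}_{\hat\imath}$ (the word $x_1\cdots x_m$ with $x_i$ deleted) for some $i\in[m]$, or $\mathbf{u}_{\mathbf{x}}=\mathbf{x}$ and $\mathbf{u}_{\mathbf{y}}=y_j$ for some $j\in[n]$.
   Context: Disjoint alphabets $X=\{x_1,\dots,x_m\}$, $Y=\{y_1,\dots,y_n\}$; $\mathbf{x}=x_1\cdots x_m$. A word is simple if it has no repeated letter. $\mathsf{Shuf}(m,n)$ is the set of simple words over $X\cup Y$ in which the letters of $X$ appear in increasing order of index and those of $Y$ in increasing order of index; $\mathbf{u}_{\mathbf{x}}$ (resp. $\mathbf{u}_{\mathbf{y}}$) is the subword of $\mathbf{u}$ formed by its letters from $X$ (resp. $Y$). For $\mathbf{u}=u_1\cdots u_k$, $\mathbf{u}_{\hat\imath}$ is $\mathbf{u}$ with $u_i$ deleted. Indels: $\mathbf{u}\to\mathbf{u}_{\hat\imath}$ if $u_i\in X$, and $\mathbf{u}_{\hat\imath}\to\mathbf{u}$ if $u_i\in Y$. Transpositions: $\mathbf{u}\Rightarrow\mathbf{u}'$ where $u_i\in X$, $u_{i+1}\in Y$ and $\mathbf{u}'$ is $\mathbf{u}$ with $u_i,u_{i+1}$ swapped. The bubble order $\leq_{\mathsf{bub}}$ is the reflexive transitive closure of indels and transpositions; $\mathbf{Bub}(m,n)=(\mathsf{Shuf}(m,n),\leq_{\mathsf{bub}})$,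 a finite lattice. An element of a finite lattice is join-irreducible if it covers exactly one element. -}

module Defs where

open import Data.Nat using (ℕ)
open import Data.Fin using (Fin; _<_; _≟_)
open import Data.Sum using (_⊎_; inj₁; inj₂)
open import Data.Empty using (⊥)
open import Data.Maybe using (Maybe; just; nothing)
open import Data.List using (List; []; _∷_; _++_; map; mapMaybe; filter; length; lookup; removeAt; allFin)
open import Data.List.Relation.Unary.Unique.Propositional using (Unique)
open import Data.List.Relation.Unary.Linked using (Linked)
open import Data.Product using (Σ; _×_; ∃; ∃-syntax)
open import Relation.Nullary using (¬_; ¬?)
open import Relation.Binary.PropositionalEquality using (_≡_)
open import Relation.Binary.Construct.Closure.ReflexiveTransitive using (Star)

-- Letters: inj₁ i is x_{i+1} ∈ X, inj₂ j is y_{j+1} ∈ Y (0-based indices).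
Letter : ℕ → ℕ → Set
Letter m n = Fin m ⊎ Fin n

Word : ℕ → ℕ → Set
Word m n = List (Letter m n)

xPart : ∀ {m n} → Letter m n → Maybe (Fin m)
xPart (inj₁ i) = just i
xPart (inj₂ _) = nothing

yPart : ∀ {m n} → Letter m n → Maybe (Fin n)
yPart (inj₁ _) = nothing
yPart (inj₂ j) = just j

uX : ∀ {m n} → Word m n → List (Fin m)
uX = mapMaybe xPart

uY : ∀ {m n} → Word m n → List (Fin n)
uY = mapMaybe yPart

Shuf : (m n : ℕ) → Word m n → Set
Shuf m n u = Unique u × Linked _<_ (uX u) × Linked _<_ (uY u)

IsX : ∀ {m n} → Letter m n → Set
IsX l = ∃[ i ] l ≡ inj₁ i

IsY : ∀ {m n} → Letter m n → Set
IsY l = ∃[ j ] l ≡ inj₂ j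

data Step {m n : ℕ} : Word m n → Word m n → Set where
  del   : (u : Word m n) (i : Fin (length u)) → IsX (lookup u i) → Step u (removeAt u i)
  ins   : (u : Word m n) (i : Fin (length u)) → IsY (lookup u i) → Step (removeAt u i) u
  trans : (xs ys : Word m n) (a : Fin m) (b : Fin n) →
          Step (xs ++ inj₁ a ∷ inj₂ b ∷ ys) (xs ++ inj₂ b ∷ inj₁ a ∷ ys)

BubStep : (m n : ℕ) → Word m n → Word m n → Set
BubStep m n u v = Shuf m n u × Shuf m n v × Step u v

_≤bub_ : ∀ {m n} → Word m n → Word m n → Set
_≤bub_ {m} {n} = Star (BubStep m n)

_<bub_ : ∀ {m n} → Word m n → Word m n → Set
u <bub v = u ≤bub v × ¬ (u ≡ v)

Covers : (m n : ℕ) → Word m n → Word m n → Set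
Covers m n u v = Shuf m n v × v <bub u ×
  ((w : Word m n) → Shuf m n w → v <bub w → w <bub u → ⊥)

JoinIrreducible : (m n : ℕ) → Word m n → Set
JoinIrreducible m n u =
  Σ (Word m n) λ v → Covers m n u v × ((w : Word m n) → Covers m n u w → w ≡ v)

xWord : (m n : ℕ) → Word m n
xWord m n = map inj₁ (allFin m)

xDel : (m n : ℕ) → Fin m → Word m n
xDel m n i = map inj₁ (filter (λ k → ¬? (k ≟ i)) (allFin m))

module Submission where

-- Going up in the bubble order deletes x's, inserts y's and turns x_a y_b into y_b x_a, so x's are
-- inherited downwards, while y's and the inversions (y_b before x_a) whose x survives are inherited
-- upwards. A rank function shows that the order is antisymmetric and that everything below u lies
-- (up to double negation) under a lower cover of u. Hence if u is join-irreducible with lower cover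
-- v, any a₁, a₂ < u lie below v. If every x common to a₁ and a₂ is in u and every y and inversion
-- of u occurs in a₁ or a₂, then a path from v up to u cannot start with a deletion or insertion,
-- and its first swap x_a y_b ⇒ y_b x_a creates an inversion of u that v, lying above a₁ and a₂,
-- already has. Such a pair is obtained by inserting a missing x or deleting a y of u, unless u has
-- no y and misses exactly one x, or has a single y and misses no x. Conversely, everything below
-- x_î is x, and the elements below x_P y_j x_Q are x and the words of this shape with y further
-- right, all below the one with y moved by one step.

open import Defs
open import Data.Empty using (⊥; ⊥-elim)
open import Function using (_∘′_)
open import Function.Bundles using (_⇔_; mk⇔)
open import Data.Fin as Fin using (Fin; toℕ; _≟_; _<?_)
import Data.Fin.Properties as Fin
open import Data.List using (List; []; _∷_; _++_; [_]; map; length; lookup; removeAt; allFin; filter; tabulate)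
import Data.List.Properties as List
open import Data.List.Membership.Propositional using (_∈_; _∉_)
open import Data.List.Membership.Propositional.Properties
  using (∈-++⁺ˡ; ∈-++⁺ʳ; ∈-++⁻; ∈-insert; ∈-∃++; ∈-map⁺; ∈-map⁻; ∈-filter⁺; ∈-filter⁻; ∈-allFin)
open import Data.List.Relation.Unary.All as All using (All; []; _∷_)
open import Data.List.Relation.Unary.AllPairs as AllPairs using ([]; _∷_)
open import Data.List.Relation.Unary.Any as Any using (here; there)
open import Data.List.Relation.Unary.Linked as Linked using (Linked; []; [-]; _∷_)
import Data.List.Relation.Unary.Linked.Properties as Linkedₚ
open import Data.List.Relation.Unary.Unique.Propositional using (Unique)
open import Data.Nat as ℕ using (ℕ; zero; suc; _+_; _*_; _∸_; _≤_; _<_; z≤n; s≤s)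
import Data.Nat.Properties as ℕ
open import Data.Nat.Solver using (module +-*-Solver)
open import Data.Product using (Σ; _×_; _,_; ∃-syntax; proj₁; proj₂)
open import Data.Sum using (_⊎_; inj₁; inj₂; [_,_]′)
import Data.Sum.Properties as Sum
open import Relation.Nullary using (¬_; ¬?; Dec; yes; no)
open import Relation.Nullary.Decidable using (decidable-stable)
open import Relation.Binary.Construct.Closure.ReflexiveTransitive using (ε; _◅_; _◅◅_)
open import Relation.Binary.PropositionalEquality as ≡
  using (_≡_; _≢_; refl; sym; cong; cong₂; subst; subst₂)

private
  variable
    m n k : ℕ
    A : Set

uX-++ : (p q : Word m n) → uX (p ++ q) ≡ uX p ++ uX q
uX-++ = List.mapMaybe-++ xPart

uY-++ : (p q : Word m n) → uY (p ++ q) ≡ uY p ++ uY q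
uY-++ = List.mapMaybe-++ yPart

uX-map-inj₁ : (l : List (Fin m)) → uX {n = n} (map inj₁ l) ≡ l
uX-map-inj₁ [] = refl
uX-map-inj₁ (a ∷ l) = cong (a ∷_) (uX-map-inj₁ l)

uY-map-inj₁ : (l : List (Fin m)) → uY {n = n} (map inj₁ l) ≡ []
uY-map-inj₁ [] = refl
uY-map-inj₁ (a ∷ l) = uY-map-inj₁ l

uX-insert-y : (p : Word m n) {q : Word m n} {b : Fin n} → uX (p ++ inj₂ b ∷ q) ≡ uX (p ++ q)
uX-insert-y [] = refl
uX-insert-y (inj₁ a ∷ p) = cong (a ∷_) (uX-insert-y p)
uX-insert-y (inj₂ _ ∷ p) = uX-insert-y p

uY-insert-x : (p : Word m n) {q : Word m n} {a : Fin m} → uY (p ++ inj₁ a ∷ q) ≡ uY (p ++ q)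
uY-insert-x [] = refl
uY-insert-x (inj₁ _ ∷ p) = uY-insert-x p
uY-insert-x (inj₂ b ∷ p) = cong (b ∷_) (uY-insert-x p)

uX-swap : (p : Word m n) {q : Word m n} {a : Fin m} {b : Fin n} →
  uX (p ++ inj₂ b ∷ inj₁ a ∷ q) ≡ uX (p ++ inj₁ a ∷ inj₂ b ∷ q)
uX-swap [] = refl
uX-swap (inj₁ a ∷ p) = cong (a ∷_) (uX-swap p)
uX-swap (inj₂ _ ∷ p) = uX-swap p

uY-swap : (p : Word m n) {q : Word m n} {a : Fin m} {b : Fin n} →
  uY (p ++ inj₂ b ∷ inj₁ a ∷ q) ≡ uY (p ++ inj₁ a ∷ inj₂ b ∷ q)
uY-swap [] = refl
uY-swap (inj₁ _ ∷ p) = uY-swap p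
uY-swap (inj₂ b ∷ p) = cong (b ∷_) (uY-swap p)

∈-uX⁺ : ∀ (w : Word m n) {a} → inj₁ a ∈ w → a ∈ uX w
∈-uX⁺ (inj₁ _ ∷ w) (here refl) = here refl
∈-uX⁺ (inj₁ _ ∷ w) (there h) = there (∈-uX⁺ w h)
∈-uX⁺ (inj₂ _ ∷ w) (there h) = ∈-uX⁺ w h

∈-uX⁻ : ∀ (w : Word m n) {a} → a ∈ uX w → inj₁ a ∈ w
∈-uX⁻ (inj₁ _ ∷ w) (here refl) = here refl
∈-uX⁻ (inj₁ _ ∷ w) (there h) = there (∈-uX⁻ w h)
∈-uX⁻ (inj₂ _ ∷ w) h = there (∈-uX⁻ w h)

∈-uY⁺ : ∀ (w : Word m n) {b} → inj₂ b ∈ w → b ∈ uY w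
∈-uY⁺ (inj₂ _ ∷ w) (here refl) = here refl
∈-uY⁺ (inj₂ _ ∷ w) (there h) = there (∈-uY⁺ w h)
∈-uY⁺ (inj₁ _ ∷ w) (there h) = ∈-uY⁺ w h

∈-uY⁻ : ∀ (w : Word m n) {b} → b ∈ uY w → inj₂ b ∈ w
∈-uY⁻ (inj₂ _ ∷ w) (here refl) = here refl
∈-uY⁻ (inj₂ _ ∷ w) (there h) = there (∈-uY⁻ w h)
∈-uY⁻ (inj₁ _ ∷ w) h = there (∈-uY⁻ w h)

uY≡[]⇒≡map-inj₁ : ∀ (w : Word m n) → uY w ≡ [] → w ≡ map inj₁ (uX w)
uY≡[]⇒≡map-inj₁ [] _ = refl
uY≡[]⇒≡map-inj₁ (inj₁ a ∷ w) e = cong (inj₁ a ∷_) (uY≡[]⇒≡map-inj₁ w e)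

∉-y⇒uY≡[] : ∀ (w : Word m n) → (∀ {b} → inj₂ b ∉ w) → uY w ≡ []
∉-y⇒uY≡[] [] _ = refl
∉-y⇒uY≡[] (inj₁ _ ∷ w) y∉ = ∉-y⇒uY≡[] w (y∉ ∘′ there)
∉-y⇒uY≡[] (inj₂ b ∷ w) y∉ = ⊥-elim (y∉ (here refl))

uY≡[]⇒y∉ : ∀ (w : Word m n) {b} → uY w ≡ [] → inj₂ b ∉ w
uY≡[]⇒y∉ w noY h with () ← subst (_ ∈_) noY (∈-uY⁺ w h)

y∉map-inj₁ : ∀ (l : List (Fin m)) {b : Fin n} → inj₂ b ∉ map inj₁ l
y∉map-inj₁ l = uY≡[]⇒y∉ (map inj₁ l) (uY-map-inj₁ l)

-- Strictly increasing lists of indices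

Sorted : List (Fin k) → Set
Sorted = Linked Fin._<_

sorted⇒head<tail : ∀ {a : Fin k} {l} → Sorted (a ∷ l) → All (a Fin.<_) l
sorted⇒head<tail [-] = []
sorted⇒head<tail (a<b ∷ s) = Linkedₚ.Linked⇒All Fin.<-trans a<b s

sorted⇒unique : {l : List (Fin k)} → Sorted l → Unique l
sorted⇒unique s = AllPairs.map Fin.<⇒≢ (Linkedₚ.Linked⇒AllPairs Fin.<-trans s)

sorted-head-≡ : ∀ {a b : Fin k} {l l′} → Sorted (a ∷ l) → Sorted (b ∷ l′) →
  (∀ {c} → c ∈ a ∷ l → c ∈ b ∷ l′) → (∀ {c} → c ∈ b ∷ l′ → c ∈ a ∷ l) → a ≡ b
sorted-head-≡ s s′ f g with f (here refl) | g (here refl)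
... | here a≡b | _ = a≡b
... | there _ | here b≡a = sym b≡a
... | there a∈l′ | there b∈l =
  ⊥-elim (Fin.<-asym (All.lookup (sorted⇒head<tail s) b∈l) (All.lookup (sorted⇒head<tail s′) a∈l′))

sorted-⊆-tail : ∀ {a : Fin k} {l l′} → Sorted (a ∷ l) →
  (∀ {c} → c ∈ a ∷ l → c ∈ a ∷ l′) → ∀ {c} → c ∈ l → c ∈ l′
sorted-⊆-tail s f c∈l with f (there c∈l)
... | here refl = ⊥-elim (Fin.<-irrefl refl (All.lookup (sorted⇒head<tail s) c∈l))
... | there c∈l′ = c∈l′

sorted-≡ : {l l′ : List (Fin k)} → Sorted l → Sorted l′ →
  (∀ {c} → c ∈ l → c ∈ l′) → (∀ {c} → c ∈ l′ → c ∈ l) → l ≡ l′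
sorted-≡ {l = []} {[]} _ _ _ _ = refl
sorted-≡ {l = []} {_ ∷ _} _ _ _ g with () ← g (here refl)
sorted-≡ {l = _ ∷ _} {[]} _ _ f _ with () ← f (here refl)
sorted-≡ {l = a ∷ l} {b ∷ l′} s s′ f g with refl ← sorted-head-≡ s s′ f g =
  cong (a ∷_) (sorted-≡ (Linked.tail s) (Linked.tail s′) (sorted-⊆-tail s f) (sorted-⊆-tail s′ g))

sorted⇒length+head< : ∀ {a : Fin k} {l} → Sorted (a ∷ l) → length l + toℕ a < k
sorted⇒length+head< {a = a} [-] = Fin.toℕ<n a
sorted⇒length+head< {a = a} {_ ∷ l} (a<b ∷ s) = ℕ.≤-<-trans
  (ℕ.≤-trans (ℕ.≤-reflexive (sym (ℕ.+-suc (length l) (toℕ a)))) (ℕ.+-monoʳ-≤ (length l) a<b))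
  (sorted⇒length+head< s)

sorted⇒length≤ : {l : List (Fin k)} → Sorted l → length l ≤ k
sorted⇒length≤ [] = z≤n
sorted⇒length≤ {l = a ∷ l} s = ℕ.≤-trans (s≤s (ℕ.m≤m+n (length l) (toℕ a))) (sorted⇒length+head< s)

tabulate-sorted : {f : Fin m → Fin k} → (∀ {i j} → i Fin.< j → f i Fin.< f j) → Sorted (tabulate f)
tabulate-sorted {zero} _ = []
tabulate-sorted {suc zero} _ = [-]
tabulate-sorted {suc (suc m)} mono = mono (s≤s z≤n) ∷ tabulate-sorted (λ i<j → mono (s≤s i<j))

allFin-sorted : ∀ m → Sorted (allFin m)
allFin-sorted m = tabulate-sorted (λ i<j → i<j)

sorted-remove : ∀ (l : List (Fin k)) {a l′} → Sorted (l ++ a ∷ l′) → Sorted (l ++ l′)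
sorted-remove [] s = Linked.tail s
sorted-remove (_ ∷ []) {l′ = []} _ = [-]
sorted-remove (_ ∷ []) {l′ = _ ∷ _} (r ∷ r′ ∷ s) = Fin.<-trans r r′ ∷ s
sorted-remove (_ ∷ b ∷ l) (r ∷ s) = r ∷ sorted-remove (b ∷ l) s

insert : Fin k → List (Fin k) → List (Fin k)
insert a [] = [ a ]
insert a (b ∷ l) with b <? a
... | yes _ = b ∷ insert a l
... | no _ = a ∷ b ∷ l

private
  ≮∧≢⇒> : {a b : Fin k} → ¬ b Fin.< a → a ≢ b → a Fin.< b
  ≮∧≢⇒> b≮a a≢b = Fin.≤∧≢⇒< (ℕ.≮⇒≥ b≮a) a≢b

  insert-sorted-∷ : ∀ {a b : Fin k} {l} → b Fin.< a → Sorted (b ∷ l) → a ∉ l → Sorted (b ∷ insert a l)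
  insert-sorted-∷ {l = []} b<a _ _ = b<a ∷ [-]
  insert-sorted-∷ {a = a} {l = c ∷ l} b<a (b<c ∷ s) a∉ with c <? a
  ... | yes c<a = b<c ∷ insert-sorted-∷ c<a s (a∉ ∘′ there)
  ... | no c≮a = b<a ∷ ≮∧≢⇒> c≮a (a∉ ∘′ here) ∷ s

insert-sorted : ∀ {a : Fin k} {l} → Sorted l → a ∉ l → Sorted (insert a l)
insert-sorted {l = []} _ _ = [-]
insert-sorted {a = a} {l = b ∷ l} s a∉ with b <? a
... | yes b<a = insert-sorted-∷ b<a s (a∉ ∘′ there)
... | no b≮a = ≮∧≢⇒> b≮a (a∉ ∘′ here) ∷ s

projections-unique⇒unique : ∀ (w : Word m n) → Unique (uX w) → Unique (uY w) → Unique w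
projections-unique⇒unique [] _ _ = []
projections-unique⇒unique (inj₁ a ∷ w) (a∉ ∷ ux) uy =
  All.tabulate (λ {c} → distinct c) ∷ projections-unique⇒unique w ux uy
  where
  distinct : ∀ c → c ∈ w → inj₁ a ≢ c
  distinct (inj₁ _) c∈w refl = All.lookup a∉ (∈-uX⁺ w c∈w) refl
  distinct (inj₂ _) _ ()
projections-unique⇒unique (inj₂ b ∷ w) ux (b∉ ∷ uy) =
  All.tabulate (λ {c} → distinct c) ∷ projections-unique⇒unique w ux uy
  where
  distinct : ∀ c → c ∈ w → inj₂ b ≢ c
  distinct (inj₂ _) c∈w refl = All.lookup b∉ (∈-uY⁺ w c∈w) refl
  distinct (inj₁ _) _ ()

shuf : ∀ (w : Word m n) → Sorted (uX w) → Sorted (uY w) → Shuf m n w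
shuf w sx sy = projections-unique⇒unique w (sorted⇒unique sx) (sorted⇒unique sy) , sx , sy

shuf-map-inj₁ : ∀ {l : List (Fin m)} → Sorted l → Shuf m n (map inj₁ l)
shuf-map-inj₁ {n = n} {l = l} s =
  shuf (map inj₁ l) (subst Sorted (sym (uX-map-inj₁ l)) s) (subst Sorted (sym (uY-map-inj₁ {n = n} l)) [])

xWord-shuf : ∀ m n → Shuf m n (xWord m n)
xWord-shuf m n = shuf-map-inj₁ (allFin-sorted m)

∈-++-∷⁺ : ∀ (p : List A) {x z q} → x ∈ p ++ q → x ∈ p ++ z ∷ q
∈-++-∷⁺ p h = [ ∈-++⁺ˡ , ∈-++⁺ʳ p ∘′ there ]′ (∈-++⁻ p h)

∈-++-∷⁻ : ∀ (p : List A) {x z q} → x ∈ p ++ z ∷ q → x ≡ z ⊎ x ∈ p ++ q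
∈-++-∷⁻ p h with ∈-++⁻ p h
... | inj₁ h′ = inj₂ (∈-++⁺ˡ h′)
... | inj₂ (here x≡z) = inj₁ x≡z
... | inj₂ (there h′) = inj₂ (∈-++⁺ʳ p h′)

∈-swap : ∀ (p : List A) {x a b q} → x ∈ p ++ a ∷ b ∷ q → x ∈ p ++ b ∷ a ∷ q
∈-swap [] (here e) = there (here e)
∈-swap [] (there (here e)) = here e
∈-swap [] (there (there h)) = there (there h)
∈-swap (_ ∷ p) (here e) = here e
∈-swap (_ ∷ p) (there h) = there (∈-swap p h)

unique⇒middle∉ : ∀ (p : List A) {z q} → Unique (p ++ z ∷ q) → z ∉ p ++ q
unique⇒middle∉ [] (z∉ ∷ _) h = All.lookup z∉ h refl
unique⇒middle∉ (_ ∷ p) (c∉ ∷ _) (here z≡c) = All.lookup c∉ (∈-insert p) (sym z≡c)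
unique⇒middle∉ (_ ∷ p) (_ ∷ u) (there h) = unique⇒middle∉ p u h

removeAt-decomposition : ∀ (u : List A) (i : Fin (length u)) →
  Σ (List A) λ p → Σ (List A) λ q → u ≡ p ++ lookup u i ∷ q × removeAt u i ≡ p ++ q
removeAt-decomposition (x ∷ u) Fin.zero = [] , u , refl , refl
removeAt-decomposition (x ∷ u) (Fin.suc i) with p , q , u≡ , removed≡ ← removeAt-decomposition u i =
  x ∷ p , q , cong (x ∷_) u≡ , cong (x ∷_) removed≡

middle : ∀ (p : List A) z q → Fin (length (p ++ z ∷ q))
middle [] _ _ = Fin.zero
middle (_ ∷ p) z q = Fin.suc (middle p z q)

lookup-middle : ∀ (p : List A) z q → lookup (p ++ z ∷ q) (middle p z q) ≡ z
lookup-middle [] _ _ = refl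
lookup-middle (_ ∷ p) z q = lookup-middle p z q

removeAt-middle : ∀ (p : List A) z q → removeAt (p ++ z ∷ q) (middle p z q) ≡ p ++ q
removeAt-middle [] _ _ = refl
removeAt-middle (x ∷ p) z q = cong (x ∷_) (removeAt-middle p z q)

data Before (c d : A) : List A → Set where
  before-here : ∀ {w} → d ∈ w → Before c d (c ∷ w)
  before-there : ∀ {e w} → Before c d w → Before c d (e ∷ w)

before⇒∈ : ∀ {c d : A} {w} → Before c d w → c ∈ w
before⇒∈ (before-here _) = here refl
before⇒∈ (before-there b) = there (before⇒∈ b)

before-middle : ∀ (p : List A) {c d q} → d ∈ q → Before c d (p ++ c ∷ q)
before-middle [] d∈q = before-here d∈q
before-middle (_ ∷ p) d∈q = before-there (before-middle p d∈q)

before-remove : ∀ (p : List A) {c d z q} → c ≢ z → d ≢ z →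
  Before c d (p ++ z ∷ q) → Before c d (p ++ q)
before-remove [] c≢z _ (before-here _) = ⊥-elim (c≢z refl)
before-remove [] _ _ (before-there b) = b
before-remove (_ ∷ p) _ d≢z (before-here d∈) =
  [ ⊥-elim ∘′ d≢z , before-here ]′ (∈-++-∷⁻ p d∈)
before-remove (_ ∷ p) c≢z d≢z (before-there b) = before-there (before-remove p c≢z d≢z b)

before-insert : ∀ (p : List A) {c d z q} → Before c d (p ++ q) → Before c d (p ++ z ∷ q)
before-insert [] b = before-there b
before-insert (_ ∷ p) (before-here d∈) = before-here (∈-++-∷⁺ p d∈)
before-insert (_ ∷ p) (before-there b) = before-there (before-insert p b)

before-swap : ∀ (p : List A) {c d a b q} → c ≢ a →
  Before c d (p ++ a ∷ b ∷ q) → Before c d (p ++ b ∷ a ∷ q)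
before-swap [] c≢a (before-here _) = ⊥-elim (c≢a refl)
before-swap [] _ (before-there (before-here d∈)) = before-here (there d∈)
before-swap [] _ (before-there (before-there b)) = before-there (before-there b)
before-swap (_ ∷ p) _ (before-here d∈) = before-here (∈-swap p d∈)
before-swap (_ ∷ p) c≢a (before-there b) = before-there (before-swap p c≢a b)

unique⇒¬before-reversed : ∀ (p : List A) {a c q} → Unique (p ++ a ∷ c ∷ q) → ¬ Before c a (p ++ a ∷ c ∷ q)
unique⇒¬before-reversed [] ((a≢c ∷ _) ∷ _) (before-here _) = a≢c refl
unique⇒¬before-reversed [] (a∉ ∷ _) (before-there (before-here a∈)) = All.lookup a∉ (there a∈) refl
unique⇒¬before-reversed [] (_ ∷ c∉ ∷ _) (before-there (before-there b)) = All.lookup c∉ (before⇒∈ b) refl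
unique⇒¬before-reversed (_ ∷ p) (x∉ ∷ _) (before-here _) = All.lookup x∉ (∈-++⁺ʳ p (there (here refl))) refl
unique⇒¬before-reversed (_ ∷ p) (_ ∷ u) (before-there b) = unique⇒¬before-reversed p u b

-- Moves of the bubble order, in prefix/suffix form, and a rank function

data Move {m n : ℕ} : Word m n → Word m n → Set where
  delete-x : ∀ p q a → Move (p ++ inj₁ a ∷ q) (p ++ q)
  insert-y : ∀ p q b → Move (p ++ q) (p ++ inj₂ b ∷ q)
  swap : ∀ p q a b → Move (p ++ inj₁ a ∷ inj₂ b ∷ q) (p ++ inj₂ b ∷ inj₁ a ∷ q)

step⇒move : {u v : Word m n} → Step u v → Move u v
step⇒move (del u i (a , uᵢ≡a)) with p , q , u≡ , removed≡ ← removeAt-decomposition u i =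
  subst₂ Move (sym (≡.trans u≡ (cong (λ z → p ++ z ∷ q) uᵢ≡a))) (sym removed≡) (delete-x p q a)
step⇒move (ins u i (b , uᵢ≡b)) with p , q , u≡ , removed≡ ← removeAt-decomposition u i =
  subst₂ Move (sym removed≡) (sym (≡.trans u≡ (cong (λ z → p ++ z ∷ q) uᵢ≡b))) (insert-y p q b)
step⇒move (trans p q a b) = swap p q a b

move⇒step : {u v : Word m n} → Move u v → Step u v
move⇒step (delete-x p q a) = subst (Step _) (removeAt-middle p (inj₁ a) q)
  (del (p ++ inj₁ a ∷ q) (middle p (inj₁ a) q) (a , lookup-middle p (inj₁ a) q))
move⇒step (insert-y p q b) = subst (λ u → Step u (p ++ inj₂ b ∷ q)) (removeAt-middle p (inj₂ b) q)
  (ins (p ++ inj₂ b ∷ q) (middle p (inj₂ b) q) (b , lookup-middle p (inj₂ b) q))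
move⇒step (swap p q a b) = trans p q a b

bubStep⇒move : {u v : Word m n} → BubStep m n u v → Move u v
bubStep⇒move (_ , _ , s) = step⇒move s

move-x⁻ : ∀ {u v : Word m n} {a} → Move u v → inj₁ a ∈ v → inj₁ a ∈ u
move-x⁻ (delete-x p _ _) h = ∈-++-∷⁺ p h
move-x⁻ (insert-y p _ _) h with ∈-++-∷⁻ p h
... | inj₂ h′ = h′
move-x⁻ (swap p _ _ _) h = ∈-swap p h

move-y⁺ : ∀ {u v : Word m n} {b} → Move u v → inj₂ b ∈ u → inj₂ b ∈ v
move-y⁺ (delete-x p _ _) h with ∈-++-∷⁻ p h
... | inj₂ h′ = h′
move-y⁺ (insert-y p _ _) h = ∈-++-∷⁺ p h
move-y⁺ (swap p _ _ _) h = ∈-swap p h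

Inversion : Fin n → Fin m → Word m n → Set
Inversion b a = Before (inj₂ b) (inj₁ a)

move-inversion⁺ : ∀ {u v : Word m n} {a b} → Unique u → Move u v → inj₁ a ∈ v →
  Inversion b a u → Inversion b a v
move-inversion⁺ u! (delete-x p q _) a∈v = before-remove p (λ ())
  (λ a≡ → unique⇒middle∉ p u! (subst (_∈ p ++ q) a≡ a∈v))
move-inversion⁺ _ (insert-y p _ _) _ = before-insert p
move-inversion⁺ _ (swap p _ _ _) _ = before-swap p (λ ())

≤bub-x⁻ : ∀ {u v : Word m n} {a} → u ≤bub v → inj₁ a ∈ v → inj₁ a ∈ u
≤bub-x⁻ ε h = h
≤bub-x⁻ (s ◅ r) h = move-x⁻ (bubStep⇒move s) (≤bub-x⁻ r h)

≤bub-y⁺ : ∀ {u v : Word m n} {b} → u ≤bub v → inj₂ b ∈ u → inj₂ b ∈ v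
≤bub-y⁺ ε h = h
≤bub-y⁺ (s ◅ r) h = ≤bub-y⁺ r (move-y⁺ (bubStep⇒move s) h)

≤bub-inversion⁺ : ∀ {u v : Word m n} {a b} → u ≤bub v → inj₁ a ∈ v →
  Inversion b a u → Inversion b a v
≤bub-inversion⁺ ε _ i = i
≤bub-inversion⁺ (s@((u! , _) , _) ◅ r) a∈v i =
  ≤bub-inversion⁺ r a∈v (move-inversion⁺ u! (bubStep⇒move s) (≤bub-x⁻ r a∈v) i)

inversionsFrom : ℕ → Word m n → ℕ
inversionsFrom c [] = 0
inversionsFrom c (inj₁ _ ∷ w) = c + inversionsFrom c w
inversionsFrom c (inj₂ _ ∷ w) = inversionsFrom (suc c) w

-- Deleting an x removes at most n inversions, which the weight suc n of a missing x outweighs.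
rank : Word m n → ℕ
rank {m} {n} w = suc n * (m ∸ length (uX w)) + length (uY w) + inversionsFrom 0 w

length-uX-insert-x : ∀ (p : Word m n) {q a} → length (uX (p ++ inj₁ a ∷ q)) ≡ suc (length (uX (p ++ q)))
length-uX-insert-x [] = refl
length-uX-insert-x (inj₁ _ ∷ p) = cong suc (length-uX-insert-x p)
length-uX-insert-x (inj₂ _ ∷ p) = length-uX-insert-x p

length-uY-insert-y : ∀ (p : Word m n) {q b} → length (uY (p ++ inj₂ b ∷ q)) ≡ suc (length (uY (p ++ q)))
length-uY-insert-y [] = refl
length-uY-insert-y (inj₁ _ ∷ p) = length-uY-insert-y p
length-uY-insert-y (inj₂ _ ∷ p) = cong suc (length-uY-insert-y p)

inversionsFrom-mono : ∀ (w : Word m n) {c d} → c ≤ d → inversionsFrom c w ≤ inversionsFrom d w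
inversionsFrom-mono [] _ = z≤n
inversionsFrom-mono (inj₁ _ ∷ w) c≤d = ℕ.+-mono-≤ c≤d (inversionsFrom-mono w c≤d)
inversionsFrom-mono (inj₂ _ ∷ w) c≤d = inversionsFrom-mono w (s≤s c≤d)

inversionsFrom-insert-x : ∀ (p : Word m n) {q a} c →
  inversionsFrom c (p ++ inj₁ a ∷ q) ≡ (c + length (uY p)) + inversionsFrom c (p ++ q)
inversionsFrom-insert-x [] {q} c = cong (_+ inversionsFrom c q) (sym (ℕ.+-identityʳ c))
inversionsFrom-insert-x (inj₁ _ ∷ p) {q} {a} c
  rewrite inversionsFrom-insert-x p {q} {a} c =
  solve 3 (λ c y r → c :+ ((c :+ y) :+ r) := (c :+ y) :+ (c :+ r)) refl c (length (uY p)) (inversionsFrom c (p ++ q))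
  where open +-*-Solver
inversionsFrom-insert-x (inj₂ _ ∷ p) {q} {a} c
  rewrite inversionsFrom-insert-x p {q} {a} (suc c) =
  cong (_+ inversionsFrom (suc c) (p ++ q)) (sym (ℕ.+-suc c (length (uY p))))

inversionsFrom-insert-y : ∀ (p : Word m n) {q b} c → inversionsFrom c (p ++ q) ≤ inversionsFrom c (p ++ inj₂ b ∷ q)
inversionsFrom-insert-y [] {q} c = inversionsFrom-mono q (ℕ.n≤1+n c)
inversionsFrom-insert-y (inj₁ _ ∷ p) c = ℕ.+-monoʳ-≤ c (inversionsFrom-insert-y p c)
inversionsFrom-insert-y (inj₂ _ ∷ p) c = inversionsFrom-insert-y p (suc c)

inversionsFrom-swap : ∀ (p : Word m n) {q a b} c →
  inversionsFrom c (p ++ inj₂ b ∷ inj₁ a ∷ q) ≡ suc (inversionsFrom c (p ++ inj₁ a ∷ inj₂ b ∷ q))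
inversionsFrom-swap [] c = refl
inversionsFrom-swap (inj₁ _ ∷ p) {q} {a} {b} c rewrite inversionsFrom-swap p {q} {a} {b} c = ℕ.+-suc c _
inversionsFrom-swap (inj₂ _ ∷ p) c = inversionsFrom-swap p (suc c)

length-uY-++ˡ : ∀ (p q : Word m n) → length (uY p) ≤ length (uY (p ++ q))
length-uY-++ˡ [] _ = z≤n
length-uY-++ˡ (inj₁ _ ∷ p) q = length-uY-++ˡ p q
length-uY-++ˡ (inj₂ _ ∷ p) q = s≤s (length-uY-++ˡ p q)

rank-move : ∀ {u v : Word m n} → Shuf m n u → Move u v → rank u < rank v
rank-move {m} {n} (_ , sx , sy) (delete-x p q a)
  rewrite length-uX-insert-x p {q} {a} | uY-insert-x p {q} {a} | inversionsFrom-insert-x p {q} {a} 0 = begin-strict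
  suc n * K + Y + (length (uY p) + R) ≤⟨ ℕ.+-monoʳ-≤ (suc n * K + Y) (ℕ.+-monoˡ-≤ R c≤n) ⟩
  suc n * K + Y + (n + R)             <⟨ ℕ.n<1+n _ ⟩
  suc (suc n * K + Y + (n + R))       ≡⟨ solve 4 (λ n K Y R → con 1 :+ ((con 1 :+ n) :* K :+ Y :+ (n :+ R))
                                          := (con 1 :+ n) :* (con 1 :+ K) :+ Y :+ R) refl n K Y R ⟩
  suc n * suc K + Y + R               ≡⟨ cong (λ z → suc n * z + Y + R) (ℕ.+-∸-assoc 1 X<m) ⟨
  suc n * (m ∸ X) + Y + R             ∎
  where
  open +-*-Solver
  open ℕ.≤-Reasoning
  X = length (uX (p ++ q))
  K = m ∸ suc X
  Y = length (uY (p ++ q))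
  R = inversionsFrom 0 (p ++ q)
  X<m : suc X ≤ m
  X<m = subst (_≤ m) (length-uX-insert-x p) (sorted⇒length≤ sx)
  c≤n : length (uY p) ≤ n
  c≤n = ℕ.≤-trans (length-uY-++ˡ p q) (sorted⇒length≤ sy)
rank-move {m} {n} _ (insert-y p q b) rewrite uX-insert-y p {q} {b} | length-uY-insert-y p {q} {b} = begin-strict
  K + Y + inversionsFrom 0 (p ++ q)                 <⟨ s≤s (ℕ.+-monoʳ-≤ (K + Y) (inversionsFrom-insert-y p 0)) ⟩
  suc (K + Y + inversionsFrom 0 (p ++ inj₂ b ∷ q))  ≡⟨ cong (_+ inversionsFrom 0 (p ++ inj₂ b ∷ q)) (ℕ.+-suc K Y) ⟨
  K + suc Y + inversionsFrom 0 (p ++ inj₂ b ∷ q)    ∎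
  where
  open ℕ.≤-Reasoning
  K = suc n * (m ∸ length (uX (p ++ q)))
  Y = length (uY (p ++ q))
rank-move _ (swap p q a b) rewrite uX-swap p {q} {a} {b} | uY-swap p {q} {a} {b} | inversionsFrom-swap p {q} {a} {b} 0 =
  ℕ.≤-reflexive (sym (ℕ.+-suc _ _))

rank-≤bub : ∀ {u v : Word m n} → u ≤bub v → rank u ≤ rank v
rank-≤bub ε = ℕ.≤-refl
rank-≤bub (s ◅ r) = ℕ.≤-trans (ℕ.<⇒≤ (rank-move (proj₁ s) (bubStep⇒move s))) (rank-≤bub r)

rank-<bub : ∀ {u v : Word m n} → u <bub v → rank u < rank v
rank-<bub (ε , u≢u) = ⊥-elim (u≢u refl)
rank-<bub (s ◅ r , _) = ℕ.<-≤-trans (rank-move (proj₁ s) (bubStep⇒move s)) (rank-≤bub r)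

_≟w_ : (u v : Word m n) → Dec (u ≡ v)
_≟w_ = List.≡-dec (Sum.≡-dec _≟_ _≟_)

≤bub-antisym : ∀ {u v : Word m n} → u ≤bub v → v ≤bub u → u ≡ v
≤bub-antisym {u = u} {v} u≤v v≤u with u ≟w v
... | yes u≡v = u≡v
... | no u≢v = ⊥-elim (ℕ.<⇒≱ (rank-<bub (u≤v , u≢v)) (rank-≤bub v≤u))

-- Covers and join-irreducibility

<bub⇒shuf : ∀ {a u : Word m n} → a <bub u → Shuf m n a
<bub⇒shuf (ε , a≢a) = ⊥-elim (a≢a refl)
<bub⇒shuf (s ◅ _ , _) = proj₁ s

-- Classically a maximal element of [a, u) is a cover of u; constructively the double negation
-- of its existence follows by induction on the rank gap.
¬¬-cover-above : ∀ {u a : Word m n} → a <bub u → ¬ ¬ (Σ (Word m n) λ c → Covers m n u c × a ≤bub c)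
¬¬-cover-above {m} {n} {u} {a} a<u = go _ (ℕ.n<1+n _) a<u
  where
  go : ∀ k {a} → rank u ∸ rank a < k → a <bub u → ¬ ¬ (Σ (Word m n) λ c → Covers m n u c × a ≤bub c)
  go (suc k) {a} gap a<u no-cover = no-cover (a , (<bub⇒shuf a<u , a<u , between) , ε)
    where
    between : (w : Word m n) → Shuf m n w → a <bub w → w <bub u → ⊥
    between w _ a<w w<u =
      go k (ℕ.<-≤-trans (ℕ.∸-monoʳ-< (rank-<bub a<w) (rank-≤bub (proj₁ w<u))) (ℕ.s≤s⁻¹ gap)) w<u
        (λ (c , cover , w≤c) → no-cover (c , cover , proj₁ a<w ◅◅ w≤c))

unique-cover⇒below : ∀ {u v a : Word m n} → ((w : Word m n) → Covers m n u w → w ≡ v) →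
  a <bub u → ¬ ¬ (a ≤bub v)
unique-cover⇒below {v = v} {a} unique a<u a≰v =
  ¬¬-cover-above a<u (λ (c , cover , a≤c) → a≰v (subst (a ≤bub_) (unique c cover) a≤c))

greatest-below⇒joinIrreducible : ∀ {u v : Word m n} → Shuf m n v → v <bub u →
  (∀ w → Shuf m n w → w <bub u → w ≤bub v) → JoinIrreducible m n u
greatest-below⇒joinIrreducible {m} {n} {u} {v} v! v<u greatest = v , (v! , v<u , between) , unique
  where
  between : (w : Word m n) → Shuf m n w → v <bub w → w <bub u → ⊥
  between w w! (v≤w , v≢w) w<u = v≢w (≤bub-antisym v≤w (greatest w w! w<u))
  unique : (w : Word m n) → Covers m n u w → w ≡ v
  unique w (w! , w<u , nothing-between) with w ≟w v
  ... | yes w≡v = w≡v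
  ... | no w≢v = ⊥-elim (nothing-between v v! (greatest w w! w<u , w≢v) v<u)

first-move-swap : ∀ {v u : Word m n} → v <bub u →
  (∀ {a} → inj₁ a ∈ v → inj₁ a ∈ u) → (∀ {b} → inj₂ b ∈ u → inj₂ b ∈ v) →
  Σ (Word m n) λ p → Σ (Word m n) λ q → Σ (Fin m) λ a → Σ (Fin n) λ b →
    v ≡ p ++ inj₁ a ∷ inj₂ b ∷ q × Inversion b a u
first-move-swap (ε , v≢v) = ⊥-elim (v≢v refl)
first-move-swap (((v! , _) , (w! , _) , s) ◅ r , _) x⊆ y⊇ with step⇒move s
... | delete-x p q a = ⊥-elim (unique⇒middle∉ p v! (≤bub-x⁻ r (x⊆ (∈-insert p))))
... | insert-y p q b = ⊥-elim (unique⇒middle∉ p w! (y⊇ (≤bub-y⁺ r (∈-insert p))))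
... | swap p q a b = p , q , a , b , refl , ≤bub-inversion⁺ r (x⊆ (∈-insert p)) (before-middle p (here refl))

spanning-pair⇒¬joinIrreducible : ∀ {u a₁ a₂ : Word m n} → a₁ <bub u → a₂ <bub u →
  (∀ {a} → inj₁ a ∈ a₁ → inj₁ a ∈ a₂ → inj₁ a ∈ u) →
  (∀ {b} → inj₂ b ∈ u → inj₂ b ∈ a₁ ⊎ inj₂ b ∈ a₂) →
  (∀ {a b} → Inversion b a u → Inversion b a a₁ ⊎ Inversion b a a₂) →
  ¬ JoinIrreducible m n u
spanning-pair⇒¬joinIrreducible {m} {n} {u} {a₁} {a₂} a₁<u a₂<u x-meet y-join inversion-join
  (v , (v! , v<u , _) , unique) =
  unique-cover⇒below unique a₁<u λ a₁≤v → unique-cover⇒below unique a₂<u λ a₂≤v → swap-impossible a₁≤v a₂≤v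
  where
  swap-impossible : a₁ ≤bub v → a₂ ≤bub v → ⊥
  swap-impossible a₁≤v a₂≤v with p , q , a , b , refl , ba∈u ←
      first-move-swap v<u (λ a∈v → x-meet (≤bub-x⁻ a₁≤v a∈v) (≤bub-x⁻ a₂≤v a∈v))
                          ([ ≤bub-y⁺ a₁≤v , ≤bub-y⁺ a₂≤v ]′ ∘′ y-join) = unique⇒¬before-reversed p (proj₁ v!)
    ([ ≤bub-inversion⁺ a₁≤v (∈-insert p) , ≤bub-inversion⁺ a₂≤v (∈-insert p) ]′ (inversion-join ba∈u))

move⇒<bub : ∀ {u v : Word m n} → Shuf m n u → Shuf m n v → Move u v → u <bub v
move⇒<bub u! v! mv = ((u! , v! , move⇒step mv) ◅ ε) , λ { refl → ℕ.<-irrefl refl (rank-move u! mv) }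

insertX-position : ∀ (i : Fin m) (w : Word m n) →
  Σ (Word m n) λ p → Σ (Word m n) λ q → w ≡ p ++ q × uX (p ++ inj₁ i ∷ q) ≡ insert i (uX w)
insertX-position i [] = [] , [] , refl , refl
insertX-position i (inj₁ a ∷ w) with a <? i
... | yes _ with p , q , w≡ , uX≡ ← insertX-position i w = inj₁ a ∷ p , q , cong (inj₁ a ∷_) w≡ , cong (a ∷_) uX≡
... | no _ = [] , inj₁ a ∷ w , refl , refl
insertX-position i (inj₂ b ∷ w) with p , q , w≡ , uX≡ ← insertX-position i w = inj₂ b ∷ p , q , cong (inj₂ b ∷_) w≡ , uX≡

insert-x-below : ∀ {w : Word m n} {i} → Shuf m n w → i ∉ uX w →
  Σ (Word m n) λ p → Σ (Word m n) λ q → w ≡ p ++ q × (p ++ inj₁ i ∷ q) <bub w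
insert-x-below {w = w} {i} w!@(_ , sx , sy) i∉ with p , q , refl , uX≡ ← insertX-position i w =
  p , q , refl , move⇒<bub (shuf _ (subst Sorted (sym uX≡) (insert-sorted sx i∉)) (subst Sorted (sym (uY-insert-x p)) sy))
                           w! (delete-x p q i)

delete-y-below : ∀ (p q : Word m n) {b} → Shuf m n (p ++ inj₂ b ∷ q) → (p ++ q) <bub (p ++ inj₂ b ∷ q)
delete-y-below p q {b} w!@(_ , sx , sy) = move⇒<bub (shuf (p ++ q) (subst Sorted (uX-insert-y p) sx) sy′) w! (insert-y p q b)
  where
  sy′ : Sorted (uY (p ++ q))
  sy′ = subst Sorted (sym (uY-++ p q)) (sorted-remove (uY p) (subst Sorted (uY-++ p (inj₂ b ∷ q)) sy))

all-but-one-x : ∀ {w : Word m n} {i} → inj₁ i ∈ w → (∀ {a} → a ≢ i → inj₁ a ∈ w) → ∀ a → inj₁ a ∈ w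
all-but-one-x {i = i} i∈ others a with a ≟ i
... | yes refl = i∈
... | no a≢i = others a≢i

_∈?_ : (a : Fin k) (l : List (Fin k)) → Dec (a ∈ l)
a ∈? l = Any.any? (a ≟_) l

missing? : (l : List (Fin k)) → (∀ a → a ∈ l) ⊎ (∃[ a ] a ∉ l)
missing? l with Fin.any? (λ a → ¬? (a ∈? l))
... | yes missing = inj₂ missing
... | no ¬missing = inj₁ λ a → decidable-stable (a ∈? l) (λ a∉ → ¬missing (a , a∉))

y-free-≡ : ∀ {w : Word m n} {l} → Shuf m n w → Sorted l → (∀ {b} → inj₂ b ∉ w) →
  (∀ {a} → a ∈ l → inj₁ a ∈ w) → (∀ {a} → inj₁ a ∈ w → a ∈ l) → w ≡ map inj₁ l
y-free-≡ {w = w} (_ , sx , _) s y∉ f g = ≡.trans (uY≡[]⇒≡map-inj₁ w (∉-y⇒uY≡[] w y∉))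
  (cong (map inj₁) (sorted-≡ sx s (g ∘′ ∈-uX⁻ w) (∈-uX⁺ w ∘′ f)))

≡xWord : ∀ {w : Word m n} → Shuf m n w → (∀ {b} → inj₂ b ∉ w) → (∀ a → inj₁ a ∈ w) → w ≡ xWord m n
≡xWord {m} w! y∉ x∈ = y-free-≡ w! (allFin-sorted m) y∉ (λ _ → x∈ _) (λ _ → ∈-allFin _)

module _ {m n : ℕ} (i : Fin m) where

  private
    ≢i? = λ (a : Fin m) → ¬? (a ≟ i)
    kept = filter ≢i? (allFin m)
    kept-sorted : Sorted kept
    kept-sorted = Linkedₚ.filter⁺ ≢i? Fin.<-trans (allFin-sorted m)

  y∉xDel : ∀ {b} → inj₂ b ∉ xDel m n i
  y∉xDel = y∉map-inj₁ kept

  ∈-xDel : ∀ {a} → a ≢ i → inj₁ a ∈ xDel m n i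
  ∈-xDel a≢i = ∈-map⁺ inj₁ (∈-filter⁺ ≢i? (∈-allFin _) a≢i)

  i∉xDel : inj₁ i ∉ xDel m n i
  i∉xDel h with _ , i∈ , refl ← ∈-map⁻ inj₁ h = proj₂ (∈-filter⁻ ≢i? {xs = allFin m} i∈) refl

  xDel-shuf : Shuf m n (xDel m n i)
  xDel-shuf = shuf-map-inj₁ kept-sorted

  ≡xDel : ∀ {w : Word m n} → Shuf m n w → (∀ {b} → inj₂ b ∉ w) → inj₁ i ∉ w →
    (∀ {a} → a ≢ i → inj₁ a ∈ w) → w ≡ xDel m n i
  ≡xDel w! y∉ i∉ x∈ = y-free-≡ w! kept-sorted y∉
    (x∈ ∘′ proj₂ ∘′ ∈-filter⁻ ≢i? {xs = allFin m}) (λ a∈ → ∈-filter⁺ ≢i? (∈-allFin _) λ { refl → i∉ a∈ })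

  below-xDel : ∀ {w : Word m n} → Shuf m n w → w ≤bub xDel m n i → w ≡ xWord m n ⊎ w ≡ xDel m n i
  below-xDel {w} w! w≤u = by-cases (i ∈? uX w)
    where
    y∉w : ∀ {b} → inj₂ b ∉ w
    y∉w = y∉xDel ∘′ ≤bub-y⁺ w≤u
    x∈w : ∀ {a} → a ≢ i → inj₁ a ∈ w
    x∈w = ≤bub-x⁻ w≤u ∘′ ∈-xDel
    by-cases : Dec (i ∈ uX w) → w ≡ xWord m n ⊎ w ≡ xDel m n i
    by-cases (yes i∈) = inj₁ (≡xWord w! y∉w (all-but-one-x (∈-uX⁻ w i∈) x∈w))
    by-cases (no i∉) = inj₂ (≡xDel w! y∉w (i∉ ∘′ ∈-uX⁺ w) x∈w)

-- Words that are not join-irreducible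

two-missing-x⇒¬joinIrreducible : ∀ {u : Word m n} {i i′} → Shuf m n u → (∀ {b} → inj₂ b ∉ u) →
  i ≢ i′ → i ∉ uX u → i′ ∉ uX u → ¬ JoinIrreducible m n u
two-missing-x⇒¬joinIrreducible {i = i} {i′} u! y∉ i≢i′ i∉ i′∉
  with insert-x-below u! i∉ | insert-x-below u! i′∉
... | p , q , refl , a₁<u | p′ , q′ , u≡ , a₂<u =
  spanning-pair⇒¬joinIrreducible a₁<u a₂<u x-meet (⊥-elim ∘′ y∉) (⊥-elim ∘′ y∉ ∘′ before⇒∈)
  where
  x-meet : ∀ {a} → inj₁ a ∈ p ++ inj₁ i ∷ q → inj₁ a ∈ p′ ++ inj₁ i′ ∷ q′ → inj₁ a ∈ p ++ q
  x-meet h h′ with ∈-++-∷⁻ p h | ∈-++-∷⁻ p′ h′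
  ... | inj₂ a∈u | _ = a∈u
  ... | inj₁ _ | inj₂ a∈u = subst (_ ∈_) (sym u≡) a∈u
  ... | inj₁ refl | inj₁ refl = ⊥-elim (i≢i′ refl)

y-and-missing-x⇒¬joinIrreducible : ∀ {u : Word m n} {i j} → Shuf m n u → inj₂ j ∈ u → i ∉ uX u →
  ¬ JoinIrreducible m n u
y-and-missing-x⇒¬joinIrreducible u! j∈u i∉ with ∈-∃++ j∈u
... | p , q , refl with insert-x-below u! i∉
...   | p′ , q′ , u≡ , a₂<u =
  spanning-pair⇒¬joinIrreducible (delete-y-below p q u!) a₂<u (λ h _ → ∈-++-∷⁺ p h)
    (λ y∈u → inj₂ (∈-++-∷⁺ p′ (subst (_ ∈_) u≡ y∈u)))
    (λ inv → inj₂ (before-insert p′ (subst (Before _ _) u≡ inv)))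

two-y⇒¬joinIrreducible : ∀ {u : Word m n} {j₁ j₂} → Shuf m n u → j₁ ≢ j₂ → inj₂ j₁ ∈ u → inj₂ j₂ ∈ u →
  ¬ JoinIrreducible m n u
two-y⇒¬joinIrreducible {m} {n} {j₁ = j₁} {j₂} u! j₁≢j₂ j₁∈u j₂∈u with ∈-∃++ j₁∈u | ∈-∃++ j₂∈u
... | p , q , refl | p′ , q′ , u≡ =
  spanning-pair⇒¬joinIrreducible (delete-y-below p q u!)
    (subst (_ <bub_) (sym u≡) (delete-y-below p′ q′ (subst (Shuf m n) u≡ u!)))
    (λ h _ → ∈-++-∷⁺ p h) y-join inversion-join
  where
  j₁-in-a₂ : ∀ {c} → c ≡ inj₂ j₁ → c ∈ p ++ inj₂ j₁ ∷ q → c ∈ p′ ++ q′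
  j₁-in-a₂ refl h with ∈-++-∷⁻ p′ (subst (_ ∈_) u≡ h)
  ... | inj₁ refl = ⊥-elim (j₁≢j₂ refl)
  ... | inj₂ h′ = h′
  y-join : ∀ {b} → inj₂ b ∈ p ++ inj₂ j₁ ∷ q → inj₂ b ∈ p ++ q ⊎ inj₂ b ∈ p′ ++ q′
  y-join h with ∈-++-∷⁻ p h
  ... | inj₁ e = inj₂ (j₁-in-a₂ e h)
  ... | inj₂ h′ = inj₁ h′
  inversion-join : ∀ {a b} → Inversion b a (p ++ inj₂ j₁ ∷ q) →
    Inversion b a (p ++ q) ⊎ Inversion b a (p′ ++ q′)
  inversion-join {b = b} inv with b ≟ j₁
  ... | no b≢j₁ = inj₁ (before-remove p (b≢j₁ ∘′ Sum.inj₂-injective) (λ ()) inv)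
  ... | yes refl = inj₂ (before-remove p′ (j₁≢j₂ ∘′ Sum.inj₂-injective) (λ ()) (subst (Before _ _) u≡ inv))

y-free-joinIrreducible⇒xDel : ∀ {u : Word m n} → Shuf m n u → JoinIrreducible m n u → (∀ {b} → inj₂ b ∉ u) →
  ∃[ i ] u ≡ xDel m n i
y-free-joinIrreducible⇒xDel {u = u} u! ji@(v , (v! , v<u , _) , _) y∉u with missing? (uX u)
... | inj₁ all∈ = ⊥-elim (proj₂ v<u (≡.trans (≡xWord v! (y∉u ∘′ ≤bub-y⁺ (proj₁ v<u)) (λ a → ≤bub-x⁻ (proj₁ v<u) (x∈u a)))
                                                  (sym (≡xWord u! y∉u x∈u))))
  where
  x∈u : ∀ a → inj₁ a ∈ u
  x∈u a = ∈-uX⁻ u (all∈ a)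
... | inj₂ (i , i∉) with missing? (i ∷ uX u)
...   | inj₂ (i′ , i′∉) =
  ⊥-elim (two-missing-x⇒¬joinIrreducible u! y∉u (λ { refl → i′∉ (here refl) }) i∉ (i′∉ ∘′ there) ji)
...   | inj₁ all∈ = i , ≡xDel i u! y∉u (i∉ ∘′ ∈-uX⁺ u) (λ a≢i → ∈-uX⁻ u (other a≢i (all∈ _)))
  where
  other : ∀ {a} → a ≢ i → a ∈ i ∷ uX u → a ∈ uX u
  other a≢i (here a≡i) = ⊥-elim (a≢i a≡i)
  other _ (there a∈) = a∈

joinIrreducible-with-y⇒all-x : ∀ {u : Word m n} {j} → Shuf m n u → JoinIrreducible m n u → inj₂ j ∈ u →
  uX u ≡ allFin m
joinIrreducible-with-y⇒all-x {m} {u = u} u!@(_ , sx , _) ji j∈u with missing? (uX u)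
... | inj₁ all∈ = sorted-≡ sx (allFin-sorted m) (λ _ → ∈-allFin _) (λ _ → all∈ _)
... | inj₂ (i , i∉) = ⊥-elim (y-and-missing-x⇒¬joinIrreducible u! j∈u i∉ ji)

joinIrreducible⇒shape : ∀ {u : Word m n} → Shuf m n u → JoinIrreducible m n u →
  (∃[ i ] u ≡ xDel m n i) ⊎ (uX u ≡ allFin m × ∃[ j ] uY u ≡ j ∷ [])
joinIrreducible⇒shape {u = u} u! ji with uY u in uY≡ | proj₂ (proj₂ u!)
... | [] | _ = inj₁ (y-free-joinIrreducible⇒xDel u! ji (uY≡[]⇒y∉ u uY≡))
... | j ∷ [] | _ = inj₂ (joinIrreducible-with-y⇒all-x u! ji (∈-uY⁻ u (subst (j ∈_) (sym uY≡) (here refl))) , j , refl)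
... | j₁ ∷ j₂ ∷ _ | j₁<j₂ ∷ _ =
  ⊥-elim (two-y⇒¬joinIrreducible u! (Fin.<⇒≢ j₁<j₂) (y∈u (here refl)) (y∈u (there (here refl))) ji)
  where
  y∈u : ∀ {b} → b ∈ j₁ ∷ j₂ ∷ _ → inj₂ b ∈ u
  y∈u = ∈-uY⁻ u ∘′ subst (_ ∈_) (sym uY≡)

xDel-joinIrreducible : ∀ i → JoinIrreducible m n (xDel m n i)
xDel-joinIrreducible {m} {n} i with insert-x-below (xDel-shuf i) (i∉xDel i ∘′ ∈-uX⁻ _)
... | p , q , _ , x<u@(x≤u , x≢u) = greatest-below⇒joinIrreducible (xWord-shuf m n) (subst (_<bub _) x≡ x<u) below
  where
  x≡ : p ++ inj₁ i ∷ q ≡ xWord m n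
  x≡ = [ (λ e → e) , ⊥-elim ∘′ x≢u ]′ (below-xDel i (<bub⇒shuf x<u) x≤u)
  below : ∀ w → Shuf m n w → w <bub xDel m n i → w ≤bub xWord m n
  below w w! (w≤u , w≢u) with below-xDel i w! w≤u
  ... | inj₁ refl = ε
  ... | inj₂ w≡u = ⊥-elim (w≢u w≡u)

-- The words x_P y_j x_Q containing every x are join-irreducible

⊆-suffix : ∀ {P Q P′ Q′ : List A} → Unique (P ++ Q) → P′ ++ Q′ ≡ P ++ Q → (∀ {a} → a ∈ Q′ → a ∈ Q) →
  Σ (List A) λ R → P′ ≡ P ++ R × Q ≡ R ++ Q′
⊆-suffix {P = []} {P′ = P′} _ e _ = P′ , refl , sym e
⊆-suffix {P = x ∷ P} {P′ = []} (x∉ ∷ _) refl Q′⊆Q = ⊥-elim (All.lookup x∉ (∈-++⁺ʳ P (Q′⊆Q (here refl))) refl)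
⊆-suffix {P = x ∷ P} {P′ = y ∷ P′} (_ ∷ PQ!) e Q′⊆Q with refl , e′ ← List.∷-injective e
  with R , P′≡ , Q≡ ← ⊆-suffix PQ! e′ Q′⊆Q = R , cong (x ∷_) P′≡ , Q≡

yBetween : Fin n → List (Fin m) → List (Fin m) → Word m n
yBetween j P Q = map inj₁ P ++ inj₂ j ∷ map inj₁ Q

uX-yBetween : ∀ (j : Fin n) (P Q : List (Fin m)) → uX (yBetween j P Q) ≡ P ++ Q
uX-yBetween j P Q = begin
  uX (map inj₁ P ++ inj₂ j ∷ map inj₁ Q)  ≡⟨ uX-insert-y (map inj₁ P) ⟩
  uX (map inj₁ P ++ map inj₁ Q)           ≡⟨ uX-++ (map inj₁ P) (map inj₁ Q) ⟩
  uX (map inj₁ P) ++ uX (map inj₁ Q)      ≡⟨ cong₂ _++_ (uX-map-inj₁ P) (uX-map-inj₁ Q) ⟩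
  P ++ Q                                  ∎
  where open ≡.≡-Reasoning

uY-yBetween : ∀ (j : Fin n) (P Q : List (Fin m)) → uY (yBetween j P Q) ≡ [ j ]
uY-yBetween j P Q = ≡.trans (uY-++ (map inj₁ P) (inj₂ j ∷ map inj₁ Q))
  (cong₂ (λ l l′ → l ++ j ∷ l′) (uY-map-inj₁ P) (uY-map-inj₁ Q))

yBetween-shuf : ∀ (j : Fin n) {P Q : List (Fin m)} → P ++ Q ≡ allFin m → Shuf m n (yBetween j P Q)
yBetween-shuf {m = m} j {P} {Q} e =
  shuf _ (subst Sorted (sym (≡.trans (uX-yBetween j P Q) e)) (allFin-sorted m)) (subst Sorted (sym (uY-yBetween j P Q)) [-])

one-y-decomposition : ∀ (w : Word m n) {j} → uY w ≡ [ j ] →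
  Σ (List (Fin m)) λ P → Σ (List (Fin m)) λ Q → w ≡ yBetween j P Q
one-y-decomposition (inj₁ a ∷ w) e with P , Q , w≡ ← one-y-decomposition w e = a ∷ P , Q , cong (inj₁ a ∷_) w≡
one-y-decomposition (inj₂ b ∷ w) e with refl , noY ← List.∷-injective e =
  [] , uX w , cong (inj₂ b ∷_) (uY≡[]⇒≡map-inj₁ w noY)

inversion-yBetween : ∀ {j : Fin n} {a} (P Q : List (Fin m)) → Inversion j a (yBetween j P Q) → a ∈ Q
inversion-yBetween [] Q (before-here a∈) with _ , a∈Q , refl ← ∈-map⁻ inj₁ a∈ = a∈Q
inversion-yBetween [] Q (before-there inv) = ⊥-elim (y∉map-inj₁ Q (before⇒∈ inv))
inversion-yBetween (_ ∷ P) Q (before-there inv) = inversion-yBetween P Q inv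

yBetween-move : ∀ (j : Fin n) (P Q : List (Fin m)) a → Move (yBetween j (P ++ [ a ]) Q) (yBetween j P (a ∷ Q))
yBetween-move j P Q a = subst (λ w → Move w (yBetween j P (a ∷ Q))) (sym split) (swap (map inj₁ P) (map inj₁ Q) a j)
  where
  split : yBetween j (P ++ [ a ]) Q ≡ map inj₁ P ++ inj₁ a ∷ inj₂ j ∷ map inj₁ Q
  split = ≡.trans (cong (_++ inj₂ j ∷ map inj₁ Q) (List.map-++ inj₁ P [ a ])) (List.++-assoc (map inj₁ P) _ _)

yBetween-≤bub : ∀ (j : Fin n) R {P Q : List (Fin m)} → P ++ R ++ Q ≡ allFin m →
  yBetween j (P ++ R) Q ≤bub yBetween j P (R ++ Q)
yBetween-≤bub j [] {P} {Q} _ = subst (λ P′ → yBetween j P′ Q ≤bub yBetween j P Q) (sym (List.++-identityʳ P)) ε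
yBetween-≤bub j (a ∷ R) {P} {Q} e =
  subst (λ P′ → yBetween j P′ Q ≤bub yBetween j (P ++ [ a ]) (R ++ Q)) (List.++-assoc P [ a ] R) (yBetween-≤bub j R e′)
  ◅◅ ((yBetween-shuf j {P ++ [ a ]} {R ++ Q} e′ , yBetween-shuf j {P} {a ∷ R ++ Q} e ,
       move⇒step (yBetween-move j P (R ++ Q) a)) ◅ ε)
  where
  e′ : (P ++ [ a ]) ++ R ++ Q ≡ allFin _
  e′ = ≡.trans (List.++-assoc P [ a ] (R ++ Q)) e

xWord-<bub-yBetween : ∀ (j : Fin n) {P Q : List (Fin m)} → P ++ Q ≡ allFin m → xWord m n <bub yBetween j P Q
xWord-<bub-yBetween {n = n} {m = m} j {P} {Q} e =
  move⇒<bub (xWord-shuf m n) (yBetween-shuf j e) (subst (λ w → Move w (yBetween j P Q)) (sym x≡) (insert-y (map inj₁ P) (map inj₁ Q) j))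
  where
  x≡ : xWord m n ≡ map inj₁ P ++ map inj₁ Q
  x≡ = ≡.trans (cong (map inj₁) (sym e)) (List.map-++ inj₁ P Q)

≤bub-all-x : ∀ {w u : Word m n} → w ≤bub u → uX u ≡ allFin m → ∀ a → inj₁ a ∈ w
≤bub-all-x {u = u} w≤u uX≡ a = ≤bub-x⁻ w≤u (∈-uX⁻ u (subst (a ∈_) (sym uX≡) (∈-allFin a)))

≤bub-one-y : ∀ {w u : Word m n} {j b} → w ≤bub u → uY u ≡ [ j ] → inj₂ b ∈ w → b ≡ j
≤bub-one-y {u = u} w≤u uY≡ y∈ with here b≡j ← subst (_ ∈_) uY≡ (∈-uY⁺ u (≤bub-y⁺ w≤u y∈)) = b≡j

yBetween-below-yBetween : ∀ {j : Fin n} {P Q P′ Q′ : List (Fin m)} → P ++ Q ≡ allFin m →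
  Shuf m n (yBetween j P′ Q′) → yBetween j P′ Q′ <bub yBetween j P Q →
  Σ (Fin m) λ a → Σ (List (Fin m)) λ R → Q ≡ a ∷ R ++ Q′ × P′ ≡ P ++ a ∷ R
yBetween-below-yBetween {m = m} {j = j} {P} {Q} {P′} {Q′} e (_ , sx , _) (w≤u , w≢u)
  with ⊆-suffix {P = P} {Q} {P′} {Q′} (subst Unique (sym e) (sorted⇒unique (allFin-sorted m))) PQ′≡ Q′⊆Q
  where
  uX≡ : uX (yBetween j P Q) ≡ allFin m
  uX≡ = ≡.trans (uX-yBetween j P Q) e
  PQ′≡ : P′ ++ Q′ ≡ P ++ Q
  PQ′≡ = begin
    P′ ++ Q′                ≡⟨ uX-yBetween j P′ Q′ ⟨
    uX (yBetween j P′ Q′)   ≡⟨ sorted-≡ sx (allFin-sorted m) (λ _ → ∈-allFin _) (λ _ → ∈-uX⁺ _ (≤bub-all-x w≤u uX≡ _)) ⟩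
    allFin m                ≡⟨ e ⟨
    P ++ Q                  ∎
    where open ≡.≡-Reasoning
  Q′⊆Q : ∀ {a} → a ∈ Q′ → a ∈ Q
  Q′⊆Q a∈ = inversion-yBetween P Q
    (≤bub-inversion⁺ w≤u (∈-uX⁻ _ (subst (_ ∈_) (sym uX≡) (∈-allFin _))) (before-middle (map inj₁ P′) (∈-map⁺ inj₁ a∈)))
... | [] , refl , Q≡ = ⊥-elim (w≢u (cong₂ (yBetween j) (List.++-identityʳ P) (sym Q≡)))
... | a ∷ R , refl , Q≡ = a , R , Q≡ , refl

below-yBetween : ∀ {j : Fin n} {P Q : List (Fin m)} {w} → P ++ Q ≡ allFin m → Shuf m n w → w <bub yBetween j P Q →
  w ≡ xWord m n ⊎ Σ (Fin m) λ a → Σ (List (Fin m)) λ R → Σ (List (Fin m)) λ Q′ →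
    Q ≡ a ∷ R ++ Q′ × w ≡ yBetween j (P ++ a ∷ R) Q′
below-yBetween {j = j} {P} {Q} {w} e w!@(_ , _ , sy) w<u@(w≤u , _) with j ∈? uY w
... | no j∉ = inj₁ (≡xWord w! (λ y∈ → j∉ (subst (_∈ uY w) (only-j y∈) (∈-uY⁺ w y∈)))
                              (≤bub-all-x w≤u (≡.trans (uX-yBetween j P Q) e)))
  where
  only-j : ∀ {b} → inj₂ b ∈ w → b ≡ j
  only-j = ≤bub-one-y w≤u (uY-yBetween j P Q)
... | yes j∈ with P′ , Q′ , refl ← one-y-decomposition w
      (sorted-≡ sy [-] (λ b∈ → here (≤bub-one-y w≤u (uY-yBetween j P Q) (∈-uY⁻ w b∈))) λ { (here refl) → j∈ })
  with a , R , Q≡ , refl ← yBetween-below-yBetween e w! w<u = inj₂ (a , R , Q′ , Q≡ , refl)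

yBetween-joinIrreducible : ∀ (j : Fin n) (P Q : List (Fin m)) → P ++ Q ≡ allFin m → JoinIrreducible m n (yBetween j P Q)
yBetween-joinIrreducible {n = n} {m = m} j P [] e =
  greatest-below⇒joinIrreducible (xWord-shuf m n) (xWord-<bub-yBetween j e) below
  where
  below : ∀ w → Shuf m n w → w <bub yBetween j P [] → w ≤bub xWord m n
  below w w! w<u with below-yBetween e w! w<u
  ... | inj₁ refl = ε
yBetween-joinIrreducible j P (a ∷ Q) e =
  greatest-below⇒joinIrreducible (yBetween-shuf j e′) (move⇒<bub (yBetween-shuf j e′) (yBetween-shuf j e) (yBetween-move j P Q a)) below
  where
  e′ : (P ++ [ a ]) ++ Q ≡ allFin _
  e′ = ≡.trans (List.++-assoc P [ a ] Q) e
  below : ∀ w → Shuf _ _ w → w <bub yBetween j P (a ∷ Q) → w ≤bub yBetween j (P ++ [ a ]) Q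
  below w w! w<u with below-yBetween e w! w<u
  ... | inj₁ refl = proj₁ (xWord-<bub-yBetween j e′)
  ... | inj₂ (_ , R , Q′ , refl , refl) = subst (λ P′ → yBetween j P′ Q′ ≤bub yBetween j (P ++ [ a ]) (R ++ Q′))
    (List.++-assoc P [ a ] R) (yBetween-≤bub j R (≡.trans (List.++-assoc P [ a ] (R ++ Q′)) e))

lemma4p8 : (m n : ℕ) (u : Word m n) → Shuf m n u →
    JoinIrreducible m n u ⇔
      ((∃[ i ] u ≡ xDel m n i) ⊎ (uX u ≡ allFin m × (∃[ j ] uY u ≡ j ∷ [])))
lemma4p8 m n u u! = mk⇔ (joinIrreducible⇒shape u!) shape⇒joinIrreducible
  where
  shape⇒joinIrreducible : (∃[ i ] u ≡ xDel m n i) ⊎ (uX u ≡ allFin m × (∃[ j ] uY u ≡ j ∷ [])) →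
    JoinIrreducible m n u
  shape⇒joinIrreducible (inj₁ (i , refl)) = xDel-joinIrreducible i
  shape⇒joinIrreducible (inj₂ (uX≡ , j , uY≡)) with P , Q , refl ← one-y-decomposition u uY≡ =
    yBetween-joinIrreducible j P Q (≡.trans (sym (uX-yBetween j P Q)) uX≡)
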